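{- Let $G$ be a graph on $n \ge 9$ vertices with minimum degree $\delta(G) \ge \frac{n}{4}$. Then $g(G) \le 5$.
   Context: $g(G)$ denotes the girth of $G$, the length of a shortest cycle in $G$. -}

module Defs where

open import Data.Nat using (ℕ; zero; suc; _≤_; _*_)
open import Data.Fin using (Fin; zero; suc; inject₁; fromℕ)
open import Data.List using (length; filter)
open import Data.List.Base using (allFin)
open import Data.Product using (Σ; _×_; ∃-syntax)
open import Relation.Binary using (Decidable; Symmetric; Irreflexive)
open import Relation.Binary.PropositionalEquality using (_≡_)
open import Function.Definitions using (Injective)
open import Relation.Nullary using (¬_)

record SimpleGraph (n : ℕ) : Set₁ where
  field
    Adj    : Fin n → Fin n → Set
    adj?   : Decidable Adj
    sym    : Symmetric Adj
    irrefl : ∀ {v} → ¬ Adj v v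

open SimpleGraph public

degree : ∀ {n} → SimpleGraph n → Fin n → ℕ
degree G v = length (filter (adj? G v) (allFin _))

-- minimum degree δ(G) ≥ n/4, written without division: 4·deg(v) ≥ n for all v
MinDegreeAtLeastQuarter : ∀ {n} → SimpleGraph n → Set
MinDegreeAtLeastQuarter {n} G = ∀ v → n ≤ 4 * degree G v

-- A cycle of length (suc m) (m ≥ 2): distinct vertices c 0, …, c m with
-- c i ~ c (i+1) for i < m and c m ~ c 0.
record Cycle {n} (G : SimpleGraph n) (m : ℕ) : Set where
  field
    vtx      : Fin (suc m) → Fin n
    distinct : Injective _≡_ _≡_ vtx
    step     : ∀ (i : Fin m) → Adj G (vtx (inject₁ i)) (vtx (suc i))
    close    : Adj G (vtx (fromℕ m)) (vtx zero)

-- g(G) ≤ k : G contains a cycle of length ℓ with 3 ≤ ℓ ≤ k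
-- (girth is the minimum cycle length; ∞ if acyclic).
GirthAtMost : ∀ {n} → SimpleGraph n → ℕ → Set
GirthAtMost G k = ∃[ m ] (2 ≤ m × suc m ≤ k × Cycle G m)

-- If G has no cycle of length at most 5, the vertices reached from an edge uv by
-- non-backtracking walks of length at most 2 are pairwise distinct: two such walks
-- ending at the same vertex would close up into a cycle of length at most 5.  With
-- minimum degree δ this gives the Moore bound n ≥ 2 (1 + (δ - 1) + (δ - 1)²), which
-- exceeds 4δ as soon as δ ≥ 3; and δ ≥ n/4 ≥ 9/4 forces δ ≥ 3.
module Submission where

open import Defs hiding (sym)
open import Data.Nat using (ℕ; zero; suc; _≤_; _<_; _+_; _*_; z≤n; s≤s)
open import Data.Nat.Properties using (*-cancelˡ-<; <-≤-trans; m<m+n; <⇒≱; ≤-refl; ≤-trans)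
open import Data.Nat.Tactic.RingSolver using (solve-∀)
open import Data.Fin using (Fin; zero; suc; punchIn; inject≤; fromℕ<)
open import Data.Fin.Properties
  using (_≟_; any?; punchIn-injective; punchInᵢ≢i; inject≤-injective; suc-injective; injective⇒≤; +↔⊎; *↔×)
open import Data.List using (List; lookup; filter; allFin)
open import Data.List.Extrema.Nat using (argmin; f[argmin]≤f[xs])
open import Data.List.Membership.Propositional.Properties using (∈-lookup; ∈-filter⁻; ∈-allFin)
import Data.List.Relation.Unary.All as All
open import Data.List.Relation.Unary.AllPairs using (_∷_)
open import Data.List.Relation.Unary.Unique.Propositional using (Unique)
open import Data.List.Relation.Unary.Unique.Propositional.Properties using (filter⁺; allFin⁺)
open import Data.Vec using ([]; _∷_) renaming (lookup to vlookup)
open import Data.Vec.Relation.Unary.All using ([]; _∷_)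
open import Data.Vec.Relation.Unary.AllPairs using ([]; _∷_)
open import Data.Vec.Relation.Unary.Unique.Propositional.Properties using (lookup-injective)
open import Data.Product using (Σ-syntax; ∃-syntax; _×_; _,_; proj₁; proj₂)
open import Data.Sum using (_⊎_; inj₁; inj₂; [_,_])
open import Data.Sum.Function.Propositional using (_⊎-↔_)
open import Function.Base using (_∘_)
open import Function.Bundles using (_↔_; _↣_; Injection)
open import Function.Definitions using (Injective)
open import Function.Properties.Inverse using (↔-refl; ↔-trans; ↔⇒↣)
open import Relation.Nullary using (¬_; Dec; yes; no; contradiction)
open import Relation.Nullary.Decidable using (map′; _×-dec_; _⊎-dec_; ¬?)
open import Relation.Binary.PropositionalEquality using (_≡_; _≢_; refl; sym; trans; cong; subst; ≢-sym)

lookup-injective-unique : ∀ {a} {A : Set a} {xs : List A} →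
                          Unique xs → Injective _≡_ _≡_ (lookup xs)
lookup-injective-unique (x∉xs ∷ u) {zero}  {zero}  e = refl
lookup-injective-unique (x∉xs ∷ u) {zero}  {suc j} e = contradiction e (All.lookup x∉xs (∈-lookup j))
lookup-injective-unique (x∉xs ∷ u) {suc i} {zero}  e = contradiction (sym e) (All.lookup x∉xs (∈-lookup i))
lookup-injective-unique (x∉xs ∷ u) {suc i} {suc j} e = cong suc (lookup-injective-unique u e)

avoiding : ∀ {a} {A : Set a} {m} (_≟ᴬ_ : (x y : A) → Dec (x ≡ y))
           (g : Fin (suc m) → A) → Injective _≡_ _≡_ g → (p : A) →
           Σ[ σ ∈ (Fin m → Fin (suc m)) ] Injective _≡_ _≡_ σ × (∀ i → g (σ i) ≢ p)
avoiding _≟ᴬ_ g g-injective p with any? (λ j → g j ≟ᴬ p)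
... | yes (j , gj≡p) = punchIn j , punchIn-injective j _ _ ,
                       λ i e → punchInᵢ≢i j i (g-injective (trans e (sym gj≡p)))
... | no  g≢p        = suc , suc-injective , λ i e → g≢p (suc i , e)

4[1+m]<moore-bound : ∀ m → 2 ≤ m → 4 * suc m < (suc m + m * m) + (suc m + m * m)
4[1+m]<moore-bound (suc zero) (s≤s ())
4[1+m]<moore-bound (suc (suc j)) _ =
  subst (4 * (3 + j) <_) (sym (excess j)) (m<m+n (4 * (3 + j)) (s≤s z≤n))
  where
  excess : ∀ j → (3 + j + (2 + j) * (2 + j)) + (3 + j + (2 + j) * (2 + j))
               ≡ 4 * (3 + j) + (2 + (6 * j + 2 * (j * j)))
  excess = solve-∀

-- The nodes of a rooted tree of depth 2 in which every non-leaf has m children.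
Node : ℕ → Set
Node m = Fin (suc m) ⊎ (Fin m × Fin m)

pattern root             = inj₁ zero
pattern child i          = inj₁ (suc i)
pattern grandchild i j   = inj₂ (i , j)

Fin↔Node : ∀ {m} → Fin (suc m + m * m) ↔ Node m
Fin↔Node = ↔-trans +↔⊎ (↔-refl ⊎-↔ *↔×)

module _ {n : ℕ} (G : SimpleGraph n) where

  Adj⇒≢ : ∀ {a b} → Adj G a b → a ≢ b
  Adj⇒≢ ab refl = irrefl G ab

  private
    symm : ∀ {a b} → Adj G a b → Adj G b a
    symm = SimpleGraph.sym G

  -- Closed walks of length 3, 4 and 5 that are bound to contain a cycle of length at
  -- most 5: a closed walk of odd length contains an odd cycle, while one of length 4
  -- must not backtrack.
  data ShortClosedWalk : Set where
    triangle : ∀ {a b c} → Adj G a b → Adj G b c → Adj G c a → ShortClosedWalk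
    square   : ∀ {a b c d} → Adj G a b → Adj G b c → Adj G c d → Adj G d a →
               a ≢ c → b ≢ d → ShortClosedWalk
    pentagon : ∀ {a b c d e} → Adj G a b → Adj G b c → Adj G c d → Adj G d e → Adj G e a →
               ShortClosedWalk

  triangle⇒girth≤5 : ∀ {a b c} → Adj G a b → Adj G b c → Adj G c a → GirthAtMost G 5
  triangle⇒girth≤5 {a} {b} {c} ab bc ca = 2 , s≤s (s≤s z≤n) , s≤s (s≤s (s≤s z≤n)) , record
    { vtx      = vlookup vs
    ; distinct = lookup-injective unique _ _
    ; step     = λ { zero → ab ; (suc zero) → bc }
    ; close    = ca
    }
    where
    vs = a ∷ b ∷ c ∷ []
    unique = (Adj⇒≢ ab ∷ ≢-sym (Adj⇒≢ ca) ∷ []) ∷ (Adj⇒≢ bc ∷ []) ∷ [] ∷ []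

  square⇒girth≤5 : ∀ {a b c d} → Adj G a b → Adj G b c → Adj G c d → Adj G d a →
                   a ≢ c → b ≢ d → GirthAtMost G 5
  square⇒girth≤5 {a} {b} {c} {d} ab bc cd da a≢c b≢d =
    3 , s≤s (s≤s z≤n) , s≤s (s≤s (s≤s (s≤s z≤n))) , record
    { vtx      = vlookup vs
    ; distinct = lookup-injective unique _ _
    ; step     = λ { zero → ab ; (suc zero) → bc ; (suc (suc zero)) → cd }
    ; close    = da
    }
    where
    vs = a ∷ b ∷ c ∷ d ∷ []
    unique = (Adj⇒≢ ab ∷ a≢c ∷ ≢-sym (Adj⇒≢ da) ∷ [])
           ∷ (Adj⇒≢ bc ∷ b≢d ∷ [])
           ∷ (Adj⇒≢ cd ∷ [])
           ∷ [] ∷ []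

  -- A closed 5-walk repeating a vertex folds up into a triangle.
  pentagon⇒girth≤5 : ∀ {a b c d e} → Adj G a b → Adj G b c → Adj G c d → Adj G d e →
                     Adj G e a → GirthAtMost G 5
  pentagon⇒girth≤5 {a} {b} {c} {d} {e} ab bc cd de ea
    with a ≟ c | a ≟ d | b ≟ d | b ≟ e | c ≟ e
  ... | yes refl | _ | _ | _ | _ = triangle⇒girth≤5 cd de ea
  ... | no _ | yes refl | _ | _ | _ = triangle⇒girth≤5 ab bc cd
  ... | no _ | no _ | yes refl | _ | _ = triangle⇒girth≤5 ab de ea
  ... | no _ | no _ | no _ | yes refl | _ = triangle⇒girth≤5 bc cd de
  ... | no _ | no _ | no _ | no _ | yes refl = triangle⇒girth≤5 ab bc ea
  ... | no a≢c | no a≢d | no b≢d | no b≢e | no c≢e = 4 , s≤s (s≤s z≤n) , ≤-refl , record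
    { vtx      = vlookup vs
    ; distinct = lookup-injective unique _ _
    ; step     = λ { zero → ab ; (suc zero) → bc ; (suc (suc zero)) → cd ; (suc (suc (suc zero))) → de }
    ; close    = ea
    }
    where
    vs = a ∷ b ∷ c ∷ d ∷ e ∷ []
    unique = (Adj⇒≢ ab ∷ a≢c ∷ a≢d ∷ ≢-sym (Adj⇒≢ ea) ∷ [])
           ∷ (Adj⇒≢ bc ∷ b≢d ∷ b≢e ∷ [])
           ∷ (Adj⇒≢ cd ∷ c≢e ∷ [])
           ∷ (Adj⇒≢ de ∷ [])
           ∷ [] ∷ []

  shortClosedWalk⇒girth≤5 : ShortClosedWalk → GirthAtMost G 5
  shortClosedWalk⇒girth≤5 (triangle ab bc ca)          = triangle⇒girth≤5 ab bc ca
  shortClosedWalk⇒girth≤5 (square ab bc cd da a≢c b≢d) = square⇒girth≤5 ab bc cd da a≢c b≢d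
  shortClosedWalk⇒girth≤5 (pentagon ab bc cd de ea)    = pentagon⇒girth≤5 ab bc cd de ea

  shortClosedWalk? : Dec ShortClosedWalk
  shortClosedWalk? = map′ fromWitness toWitness
    ( any? (λ a → any? λ b → any? λ c →
        adj? G a b ×-dec adj? G b c ×-dec adj? G c a)
    ⊎-dec any? (λ a → any? λ b → any? λ c → any? λ d →
        adj? G a b ×-dec adj? G b c ×-dec adj? G c d ×-dec adj? G d a ×-dec
        ¬? (a ≟ c) ×-dec ¬? (b ≟ d))
    ⊎-dec any? (λ a → any? λ b → any? λ c → any? λ d → any? λ e →
        adj? G a b ×-dec adj? G b c ×-dec adj? G c d ×-dec adj? G d e ×-dec adj? G e a))
    where
    Triangles Squares Pentagons : Set
    Triangles = ∃[ a ] ∃[ b ] ∃[ c ] Adj G a b × Adj G b c × Adj G c a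
    Squares   = ∃[ a ] ∃[ b ] ∃[ c ] ∃[ d ]
                Adj G a b × Adj G b c × Adj G c d × Adj G d a × a ≢ c × b ≢ d
    Pentagons = ∃[ a ] ∃[ b ] ∃[ c ] ∃[ d ] ∃[ e ]
                Adj G a b × Adj G b c × Adj G c d × Adj G d e × Adj G e a

    fromWitness : Triangles ⊎ Squares ⊎ Pentagons → ShortClosedWalk
    fromWitness (inj₁ (_ , _ , _ , ab , bc , ca)) = triangle ab bc ca
    fromWitness (inj₂ (inj₁ (_ , _ , _ , _ , ab , bc , cd , da , a≢c , b≢d))) =
      square ab bc cd da a≢c b≢d
    fromWitness (inj₂ (inj₂ (_ , _ , _ , _ , _ , ab , bc , cd , de , ea))) =
      pentagon ab bc cd de ea

    toWitness : ShortClosedWalk → Triangles ⊎ Squares ⊎ Pentagons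
    toWitness (triangle ab bc ca)          = inj₁ (_ , _ , _ , ab , bc , ca)
    toWitness (square ab bc cd da a≢c b≢d) = inj₂ (inj₁ (_ , _ , _ , _ , ab , bc , cd , da , a≢c , b≢d))
    toWitness (pentagon ab bc cd de ea)    = inj₂ (inj₂ (_ , _ , _ , _ , _ , ab , bc , cd , de , ea))

  neighbourList : ∀ w →
    Σ[ f ∈ (Fin (degree G w) → Fin n) ] Injective _≡_ _≡_ f × (∀ i → Adj G w (f i))
  neighbourList w =
      lookup N
    , lookup-injective-unique (filter⁺ (adj? G w) (allFin⁺ n))
    , λ i → proj₂ (∈-filter⁻ (adj? G w) {xs = allFin n} (∈-lookup i))
    where
    N = filter (adj? G w) (allFin n)

  record Neighbours (w p : Fin n) (m : ℕ) : Set where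
    field
      nbr       : Fin m → Fin n
      injective : Injective _≡_ _≡_ nbr
      adjacent  : ∀ i → Adj G w (nbr i)
      avoids    : ∀ i → nbr i ≢ p

  neighbours : ∀ {m} w p → suc m ≤ degree G w → Neighbours w p m
  neighbours {m} w p m<deg =
    let f , f-injective , f-adjacent = neighbourList w
        g : Fin (suc m) → Fin n
        g i = f (inject≤ i m<deg)
        g-injective : Injective _≡_ _≡_ g
        g-injective = inject≤-injective m<deg m<deg _ _ ∘ f-injective
        σ , σ-injective , gσ≢p = avoiding _≟_ g g-injective p
    in record
      { nbr       = g ∘ σ
      ; injective = σ-injective ∘ g-injective
      ; adjacent  = λ i → f-adjacent (inject≤ (σ i) m<deg)
      ; avoids    = gσ≢p
      }

  -- The endpoints of the non-backtracking walks of length at most 2 from r that do not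
  -- start along the edge rs.
  record Branch (r s : Fin n) (m : ℕ) : Set where
    field
      children      : Neighbours r s m
      grandchildren : ∀ i → Neighbours (Neighbours.nbr children i) r m

    vertex : Node m → Fin n
    vertex root             = r
    vertex (child i)        = Neighbours.nbr children i
    vertex (grandchild i j) = Neighbours.nbr (grandchildren i) j

    child-adjacent : ∀ i → Adj G r (vertex (child i))
    child-adjacent = Neighbours.adjacent children

    grandchild-adjacent : ∀ i j → Adj G (vertex (child i)) (vertex (grandchild i j))
    grandchild-adjacent i = Neighbours.adjacent (grandchildren i)

    child≢s : ∀ i → vertex (child i) ≢ s
    child≢s = Neighbours.avoids children

    grandchild≢root : ∀ i j → vertex (grandchild i j) ≢ r
    grandchild≢root i = Neighbours.avoids (grandchildren i)

  branch : ∀ {m} r s → (∀ w → suc m ≤ degree G w) → Branch r s m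
  branch r s deg = record
    { children      = children
    ; grandchildren = λ i → neighbours (Neighbours.nbr children i) r (deg _)
    }
    where
    children = neighbours r s (deg r)

  module _ (noShortWalk : ¬ ShortClosedWalk) where

    module _ {r s m} (B : Branch r s m) where
      open Branch B

      child≢grandchild : ∀ i k l → vertex (child i) ≢ vertex (grandchild k l)
      child≢grandchild i k l e = noShortWalk (triangle
        (child-adjacent k)
        (subst (Adj G _) (sym e) (grandchild-adjacent k l))
        (symm (child-adjacent i)))

      grandchild-injective : ∀ i j k l → vertex (grandchild i j) ≡ vertex (grandchild k l) →
                             (i , j) ≡ (k , l)
      grandchild-injective i j k l e with i ≟ k
      ... | yes refl = cong (i ,_) (Neighbours.injective (grandchildren i) e)
      ... | no  i≢k  = contradiction
        (square (child-adjacent i) (grandchild-adjacent i j)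
                (subst (λ x → Adj G x _) (sym e) (symm (grandchild-adjacent k l)))
                (symm (child-adjacent k))
                (≢-sym (grandchild≢root i j)) (i≢k ∘ Neighbours.injective children))
        noShortWalk

      vertex-injective : Injective _≡_ _≡_ vertex
      vertex-injective {root}           {root}           e = refl
      vertex-injective {root}           {child k}        e = contradiction e (Adj⇒≢ (child-adjacent k))
      vertex-injective {root}           {grandchild k l} e = contradiction e (≢-sym (grandchild≢root k l))
      vertex-injective {child i}        {root}           e = contradiction e (≢-sym (Adj⇒≢ (child-adjacent i)))
      vertex-injective {child i}        {child k}        e = cong (λ i → child i) (Neighbours.injective children e)
      vertex-injective {child i}        {grandchild k l} e = contradiction e (child≢grandchild i k l)
      vertex-injective {grandchild i j} {root}           e = contradiction e (grandchild≢root i j)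
      vertex-injective {grandchild i j} {child k}        e = contradiction e (≢-sym (child≢grandchild k i j))
      vertex-injective {grandchild i j} {grandchild k l} e = cong inj₂ (grandchild-injective i j k l e)

    branches-disjoint : ∀ {u v m} → Adj G u v → (Bu : Branch u v m) (Bv : Branch v u m) →
                        ∀ x y → Branch.vertex Bu x ≢ Branch.vertex Bv y
    branches-disjoint uv Bu Bv = disjoint
      where
      open Branch
      disjoint : ∀ x y → vertex Bu x ≢ vertex Bv y
      disjoint root root e = Adj⇒≢ uv e
      disjoint root (child k) e = child≢s Bv k (sym e)
      disjoint root (grandchild k l) e = noShortWalk (triangle uv (child-adjacent Bv k)
        (subst (Adj G _) (sym e) (grandchild-adjacent Bv k l)))
      disjoint (child i) root e = child≢s Bu i e
      disjoint (child i) (child k) e = noShortWalk (triangle uv (child-adjacent Bv k)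
        (subst (λ x → Adj G x _) e (symm (child-adjacent Bu i))))
      disjoint (child i) (grandchild k l) e = noShortWalk (square uv (child-adjacent Bv k)
        (grandchild-adjacent Bv k l) (subst (λ x → Adj G x _) e (symm (child-adjacent Bu i)))
        (≢-sym (child≢s Bv k)) (≢-sym (grandchild≢root Bv k l)))
      disjoint (grandchild i j) root e = noShortWalk (triangle (symm uv) (child-adjacent Bu i)
        (subst (Adj G _) e (grandchild-adjacent Bu i j)))
      disjoint (grandchild i j) (child k) e = noShortWalk (square (symm uv) (child-adjacent Bu i)
        (grandchild-adjacent Bu i j) (subst (λ x → Adj G x _) (sym e) (symm (child-adjacent Bv k)))
        (≢-sym (child≢s Bu i)) (≢-sym (grandchild≢root Bu i j)))
      disjoint (grandchild i j) (grandchild k l) e = noShortWalk (pentagon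
        (child-adjacent Bu i) (grandchild-adjacent Bu i j)
        (subst (λ x → Adj G x _) (sym e) (symm (grandchild-adjacent Bv k l)))
        (symm (child-adjacent Bv k)) (symm uv))

    moore-bound : ∀ {m} → Fin n → (∀ w → suc m ≤ degree G w) →
                  (suc m + m * m) + (suc m + m * m) ≤ n
    moore-bound {m} u deg = injective⇒≤ (Injection.injective encode ∘ ball-injective)
      where
      v : Fin n
      v = proj₁ (neighbourList u) (fromℕ< (deg u))
      uv : Adj G u v
      uv = proj₂ (proj₂ (neighbourList u)) _
      Bu = branch u v deg
      Bv = branch v u deg

      ball : Node m ⊎ Node m → Fin n
      ball = [ Branch.vertex Bu , Branch.vertex Bv ]

      ball-injective : Injective _≡_ _≡_ ball
      ball-injective {inj₁ x} {inj₁ y} e = cong inj₁ (vertex-injective Bu e)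
      ball-injective {inj₁ x} {inj₂ y} e = contradiction e (branches-disjoint uv Bu Bv x y)
      ball-injective {inj₂ x} {inj₁ y} e = contradiction (sym e) (branches-disjoint uv Bu Bv y x)
      ball-injective {inj₂ x} {inj₂ y} e = cong inj₂ (vertex-injective Bv e)

      encode : Fin ((suc m + m * m) + (suc m + m * m)) ↣ (Node m ⊎ Node m)
      encode = ↔⇒↣ (↔-trans +↔⊎ (Fin↔Node ⊎-↔ Fin↔Node))

    moore-bound⇒4δ<n : ∀ {δ} → 2 < δ → (∀ w → δ ≤ degree G w) → Fin n → 4 * δ < n
    moore-bound⇒4δ<n {suc m} (s≤s 2≤m) deg u =
      <-≤-trans (4[1+m]<moore-bound m 2≤m) (moore-bound u deg)

minDegreeVertex : ∀ {n} → SimpleGraph (suc n) → Fin (suc n)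
minDegreeVertex G = argmin (degree G) zero (allFin _)

minDegree≤degree : ∀ {n} (G : SimpleGraph (suc n)) v → degree G (minDegreeVertex G) ≤ degree G v
minDegree≤degree G v = All.lookup (f[argmin]≤f[xs] {f = degree G} zero (allFin _)) (∈-allFin v)

lemma15 : (n : ℕ) → 9 ≤ n → (G : SimpleGraph n) → MinDegreeAtLeastQuarter G → GirthAtMost G 5
lemma15 zero    ()
lemma15 (suc n) 9≤n G n≤4δ with shortClosedWalk? G
... | yes walk   = shortClosedWalk⇒girth≤5 G walk
... | no  noWalk =
  contradiction (n≤4δ w) (<⇒≱ (moore-bound⇒4δ<n G noWalk 2<δ (minDegree≤degree G) w))
  where
  w = minDegreeVertex G
  2<δ : 2 < degree G w
  2<δ = *-cancelˡ-< 4 2 (degree G w) (≤-trans 9≤n (n≤4δ w))
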